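{- Let $\vec f,\vec g$ be vectors of ordinal terms with $m:=\mathrm{lv}(\vec f)>\mathrm{lv}(\vec g)=:n$ and let $k\in[1,m]$. Suppose expressions $p,q\prec\omega$ satisfy $\mathrm{no}(f_i)\preceq p$ for $k\le i\le m$ and $\mathrm{no}(g_i)\preceq q$ for $k\le i\le n$. Then $\mathrm{no}((\vec f\Box\vec g)_i)\preceq F_2(p+q+n)$ for all $k\le i\le m$.
   Context: Ordinals: for $\alpha,\beta<\varepsilon_0$, $\alpha\oplus\beta$, $\alpha\otimes\beta$ are the natural (Hessenberg) sum and product; $2^\alpha:=\omega^{\alpha_0}\cdot2^k$ for $\alpha=\omega\cdot\alpha_0+k$, $k<\omega$. Norm: $\mathrm{no}(0)=0$, $\mathrm{no}(\alpha)=k+\mathrm{no}(\alpha_1)+\dots+\mathrm{no}(\alpha_k)$ for $\alpha=\omega^{\alpha_1}+\dots+\omega^{\alpha_k}$ in Cantor normal form. $F_0(x)=2^x$, $F_{j+1}(x)=F_j^{x+1}(x)$; $\Phi(x)=F_5(x+100)$; $\psi(\alpha):=\max(\{0\}\cup\{\psi(\beta)+1:\beta<\alpha,\mathrm{no}(\beta)\le\Phi(\mathrm{no}(\alpha))\})$. Each typed variable $X^\sigma$ (types $0$, $\sigma\tau$; $\mathrm{lv}(0)=0$, $\mathrm{lv}(\sigma\tau)=\max(\mathrm{lv}\sigma+1,\mathrm{lv}\tau)$) has an associated vector $\vec x=\langle x_0,\dots,x_{\mathrm{lv}(\sigma)}\rangle$ of distinct ordinal variables, each ordinal variable in exactly one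 such vector. Ordinal terms: ordinal variables, $0,1,\omega$, $f+g$, $2^f\cdot g$, $\psi(\omega\cdot f+g)$; closed terms denote ordinals ($+$ as $\oplus$, $\cdot$ as $\otimes$). Vectors $\vec h=\langle h_0,\dots,h_n\rangle$ have level $n$, $h_i:=0$ for $i>n$. Classes $\mathcal B_i$: $1\in\mathcal B_i$; $\omega\in\mathcal B_i$ ($i\ge1$); closed under $+$; $2^f\cdot g\in\mathcal B_i$ if $f\in\mathcal B_{i+1},g\in\mathcal B_i,i\ge1$; $\psi(\omega f+g)\in\mathcal B_0$ if $f\in\mathcal B_1,g\in\mathcal B_0,\mathrm{no}(f)\le F_2(g)$; $\mathcal B_0\subseteq\mathcal B_i$. A closed vector $\vec f$ has bounded norm if $\mathrm{no}(f_i)\le\mathrm{no}(f_0)$ for all $i$. Comparison: for terms (or expressions built from terms using $\mathrm{no}$ and the $F_j$) $f,g$, $f\prec g$ ($\preceq$) means $\chi(f)<\chi(g)$ ($\le$) for all substitutions $\chi$ defined on all components of every variable vector having a component occurring in $f$ or $g$, such that each $\chi(\vec x)$ has $\chi(x_i)\in\mathcal B_i$ and is of bounded norm. $\Box$: for $m=\mathrm{lv}(\vec f)>\mathrm{lv}(\vec g)=n$, $\vec f\Box\vec g$ has level $m$: $(\vec f\Box\vec g)_0=\psi(\omega\cdot(\vec f\Box\vec g)_1+f_0+g_0+n)$, $(\vec f\Box\vec g)_i=2^{(\vec f\Box\vec g)_{i+1}}\cdot(f_i+g_i)$ for $1\le i\le n$, $(\vec f\Box\vec g)_i=f_i$ for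 $n<i\le m$. -}

module Defs where

open import Data.Nat as ℕ using (ℕ; zero; suc; _⊔_; _∸_; _^_; _≤ᵇ_)
open import Data.Bool using (Bool; true; false; if_then_else_)
open import Data.Empty using (⊥; ⊥-elim)
open import Data.Unit using (⊤; tt)
open import Data.Product using (Σ; _×_; _,_; proj₁; proj₂)
open import Data.Sum using (_⊎_; inj₁; inj₂)
open import Data.List using (List; []; _∷_; map; foldr; concatMap; mapMaybe)
open import Data.Maybe using (Maybe; just; nothing)
open import Data.Fin as Fin using (Fin; toℕ)
open import Data.Vec using (Vec; []; _∷_; tabulate)
open import Relation.Nullary as Dec using (Dec; yes; ¬_)
open import Relation.Nullary.Decidable using (_×-dec_; _⊎-dec_)
open import Relation.Binary.PropositionalEquality using (_≡_; refl)
open import Induction.WellFounded using (Acc; acc)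

-- Ordinals below ε₀ as (raw) Cantor normal form trees:
-- ω^ a + b  stands for  ω^a + b.  Normal forms are singled out by IsCNF.

infixr 30 ω^_+_
data O : Set where
  𝟎     : O
  ω^_+_ : O → O → O

infix 4 _<ₒ_ _≤ₒ_
data _<ₒ_ : O → O → Set where
  <₁ : ∀ {a b} → 𝟎 <ₒ ω^ a + b
  <₂ : ∀ {a b c d} → a <ₒ c → ω^ a + b <ₒ ω^ c + d
  <₃ : ∀ {a b c d} → a ≡ c → b <ₒ d → ω^ a + b <ₒ ω^ c + d

_≤ₒ_ : O → O → Set
a ≤ₒ b = a <ₒ b ⊎ a ≡ b

fst : O → O
fst 𝟎 = 𝟎
fst (ω^ a + _) = a

IsCNF : O → Set
IsCNF 𝟎 = ⊤
IsCNF (ω^ a + b) = IsCNF a × IsCNF b × (fst b ≤ₒ a)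

_≟ₒ_ : (a b : O) → Dec (a ≡ b)
𝟎 ≟ₒ 𝟎 = yes refl
𝟎 ≟ₒ (ω^ _ + _) = Dec.no λ ()
(ω^ _ + _) ≟ₒ 𝟎 = Dec.no λ ()
(ω^ a + b) ≟ₒ (ω^ c + d) with a ≟ₒ c | b ≟ₒ d
... | yes refl | yes refl = yes refl
... | Dec.no ¬p | _ = Dec.no λ { refl → ¬p refl }
... | yes _ | Dec.no ¬q = Dec.no λ { refl → ¬q refl }

_<?ₒ_ : (a b : O) → Dec (a <ₒ b)
_ <?ₒ 𝟎 = Dec.no λ ()
𝟎 <?ₒ (ω^ _ + _) = yes <₁
(ω^ a + b) <?ₒ (ω^ c + d) with a <?ₒ c
... | yes p = yes (<₂ p)
... | Dec.no ¬p with a ≟ₒ c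
...   | Dec.no ¬e = Dec.no λ { (<₂ p) → ¬p p ; (<₃ e _) → ¬e e }
...   | yes e with b <?ₒ d
...     | yes q = yes (<₃ e q)
...     | Dec.no ¬q = Dec.no λ { (<₂ p) → ¬p p ; (<₃ _ q) → ¬q q }

_≤?ₒ_ : (a b : O) → Dec (a ≤ₒ b)
a ≤?ₒ b = (a <?ₒ b) ⊎-dec (a ≟ₒ b)

IsCNF? : (a : O) → Dec (IsCNF a)
IsCNF? 𝟎 = yes tt
IsCNF? (ω^ a + b) = IsCNF? a ×-dec (IsCNF? b ×-dec (fst b ≤?ₒ a))

-- Natural (Hessenberg) sum and product

infixl 6 _⊕_
infixl 7 _⊗_

_⊕_ : O → O → O
𝟎 ⊕ y = y
x@(ω^ a + a') ⊕ 𝟎 = x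
(ω^ a + a') ⊕ (ω^ b + b') =
  if Dec.does (a <?ₒ b) then ω^ b + ((ω^ a + a') ⊕ b') else ω^ a + (a' ⊕ (ω^ b + b'))

mulT : O → O → O
mulT a 𝟎 = 𝟎
mulT a (ω^ b + b') = (ω^ (a ⊕ b) + 𝟎) ⊕ mulT a b'

_⊗_ : O → O → O
𝟎 ⊗ y = 𝟎
(ω^ a + a') ⊗ y = mulT a y ⊕ (a' ⊗ y)

rep : ℕ → O → O
rep zero a = 𝟎
rep (suc k) a = ω^ a + rep k a

fromℕ : ℕ → O
fromℕ k = rep k 𝟎

oneₒ ωₒ : O
oneₒ = ω^ 𝟎 + 𝟎
ωₒ = ω^ oneₒ + 𝟎

-- number of summands; for a finite ordinal this is its value
natOf : O → ℕ
natOf 𝟎 = 0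
natOf (ω^ _ + b) = suc (natOf b)

isFin : O → Bool
isFin 𝟎 = true
isFin (ω^ 𝟎 + _) = true
isFin (ω^ (ω^ _ + _) + _) = false

-- e ↦ e' with 1 + e' = e  (for e ≥ 1)
pred₁ : O → O
pred₁ (ω^ 𝟎 + r) = r
pred₁ e = e

-- α = ω·α₀ + k  ↦  (α₀ , k)   (ordinary ordinal arithmetic)
split : O → O × ℕ
split 𝟎 = 𝟎 , 0
split (ω^ 𝟎 + r) = proj₁ (split r) , suc (proj₂ (split r))
split (ω^ e@(ω^ _ + _) + r) = ω^ (pred₁ e) + proj₁ (split r) , proj₂ (split r)

-- 2^α := ω^α₀ · 2^k  for α = ω·α₀ + k
two^ : O → O
two^ α = rep (2 ^ proj₂ (split α)) (proj₁ (split α))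

no : O → ℕ
no 𝟎 = 0
no (ω^ a + b) = suc (no a ℕ.+ no b)

iter : ℕ → (ℕ → ℕ) → ℕ → ℕ
iter zero h x = x
iter (suc k) h x = h (iter k h x)

F : ℕ → ℕ → ℕ
F zero x = 2 ^ x
F (suc j) x = iter (suc x) (F j) x

Φ : ℕ → ℕ
Φ x = F 5 (x ℕ.+ 100)

CNF : Set
CNF = Σ O IsCNF

_<C_ : CNF → CNF → Set
x <C y = proj₁ x <ₒ proj₁ y

acc𝟎 : ∀ {c} → Acc _<C_ (𝟎 , c)
acc𝟎 = acc λ { {_ , _} () }

accIrr : ∀ {x c c'} → Acc _<C_ (x , c) → Acc _<C_ (x , c')
accIrr (acc rs) = acc rs

mutual
  wfT : (a : O) (ca : IsCNF a) → Acc _<C_ (a , ca) →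
        (y : O) (cy : IsCNF y) → fst y ≤ₒ a → Acc _<C_ (y , cy)
  wfT a ca acca 𝟎 cy _ = acc𝟎
  wfT a ca (acc rs) (ω^ e + d) (ce , cd , fd) (inj₁ e<a) =
    wfT e ce (rs {e , ce} e<a) (ω^ e + d) (ce , cd , fd) (inj₂ refl)
  wfT a ca (acc rs) (ω^ .a + d) (ce , cd , fd) (inj₂ refl) =
    accIrr (wfS a ca (acc rs) d cd fd (wfT a ca (acc rs) d cd fd))

  wfS : (a : O) (ca : IsCNF a) → Acc _<C_ (a , ca) →
        (d : O) (cd : IsCNF d) (fd : fst d ≤ₒ a) → Acc _<C_ (d , cd) →
        Acc _<C_ (ω^ a + d , ca , cd , fd)
  wfS a ca acca d cd fd accd =
    acc λ { {z , cz} lt → wfS' a ca acca d cd fd accd z cz lt }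

  wfS' : (a : O) (ca : IsCNF a) → Acc _<C_ (a , ca) →
         (d : O) (cd : IsCNF d) (fd : fst d ≤ₒ a) → Acc _<C_ (d , cd) →
         (z : O) (cz : IsCNF z) → z <ₒ ω^ a + d → Acc _<C_ (z , cz)
  wfS' a ca acca d cd fd accd 𝟎 cz <₁ = acc𝟎
  wfS' a ca (acc rs) d cd fd accd (ω^ c + w) (cc , cw , fw) (<₂ c<a) =
    wfT c cc (rs {c , cc} c<a) (ω^ c + w) (cc , cw , fw) (inj₂ refl)
  wfS' a ca acca d cd fd (acc rs) (ω^ .a + w) (cc , cw , fw) (<₃ refl w<d) =
    accIrr (wfS a ca acca w cw fw (rs {w , cw} w<d))

wfC : (x : CNF) → Acc _<C_ x
wfC (𝟎 , _) = acc𝟎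
wfC (ω^ a + b , ca , cb , fb) = wfT a ca (wfC (a , ca)) (ω^ a + b) (ca , cb , fb) (inj₂ refl)

-- ψ(α) = max({0} ∪ {ψ(β)+1 : β < α, no(β) ≤ Φ(no α)})

upto : ℕ → List O
upto zero = 𝟎 ∷ []
upto (suc n) = 𝟎 ∷ concatMap (λ a → concatMap (λ b →
  if no a ℕ.+ no b ≤ᵇ n then (ω^ a + b) ∷ [] else []) (upto n)) (upto n)

Cand : O → Set
Cand α = Σ O λ β → IsCNF β × β <ₒ α

pick : (α β : O) → Maybe (Cand α)
pick α β with IsCNF? β | β <?ₒ α
... | yes c | yes lt = just (β , c , lt)
... | _ | _ = nothing

cands : ℕ → (α : O) → List (Cand α)
cands N α = mapMaybe (pick α) (upto N)

maxL : List ℕ → ℕ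
maxL = foldr _⊔_ 0

ψstep : (α : O) → ((β : O) → IsCNF β → β <ₒ α → ℕ) → ℕ
ψstep α rec = maxL (map (λ { (β , c , lt) → suc (rec β c lt) }) (cands (Φ (no α)) α))

ψC : (x : CNF) → Acc _<C_ x → ℕ
ψC (α , c) (acc rs) = ψstep α (λ β cβ lt → ψC (β , cβ) (rs {β , cβ} lt))

ψ : O → ℕ
ψ α = ψstep α (λ β cβ lt → ψC (β , cβ) (wfC (β , cβ)))

infixr 5 _⇒_
data Ty : Set where
  ι   : Ty
  _⇒_ : Ty → Ty → Ty

lv : Ty → ℕ
lv ι = 0
lv (σ ⇒ τ) = suc (lv σ) ⊔ lv τ

record TVar : Set where
  constructor tv
  field
    name : ℕ
    ty   : Ty

-- the ordinal variable x_i of the vector associated with X^σ, 0 ≤ i ≤ lv(σ)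
OVar : Set
OVar = Σ TVar λ X → Fin (suc (lv (TVar.ty X)))

infixl 6 _t+_
data Term (V : Set) : Set where
  var   : V → Term V
  t0 t1 tω : Term V
  _t+_  : Term V → Term V → Term V
  t2^_·_ : Term V → Term V → Term V
  tψ    : Term V → Term V → Term V

evalWith : ∀ {V : Set} → (V → O) → Term V → O
evalWith ρ (var x) = ρ x
evalWith ρ t0 = 𝟎
evalWith ρ t1 = oneₒ
evalWith ρ tω = ωₒ
evalWith ρ (f t+ g) = evalWith ρ f ⊕ evalWith ρ g
evalWith ρ (t2^ f · g) = two^ (evalWith ρ f) ⊗ evalWith ρ g
evalWith ρ (tψ f g) = fromℕ (ψ (ωₒ ⊗ evalWith ρ f ⊕ evalWith ρ g))

⟦_⟧ : Term ⊥ → O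
⟦ t ⟧ = evalWith ⊥-elim t

_[_] : ∀ {V W : Set} → Term V → (V → Term W) → Term W
var x [ χ ] = χ x
t0 [ χ ] = t0
t1 [ χ ] = t1
tω [ χ ] = tω
(f t+ g) [ χ ] = (f [ χ ]) t+ (g [ χ ])
(t2^ f · g) [ χ ] = t2^ (f [ χ ]) · (g [ χ ])
tψ f g [ χ ] = tψ (f [ χ ]) (g [ χ ])

num : ∀ {V : Set} → ℕ → Term V
num zero = t0
num (suc k) = t1 t+ num k

data 𝓑 : ℕ → Term ⊥ → Set where
  b1 : ∀ {i} → 𝓑 i t1
  bω : ∀ {i} → 𝓑 (suc i) tω
  b+ : ∀ {i f g} → 𝓑 i f → 𝓑 i g → 𝓑 i (f t+ g)
  b2 : ∀ {i f g} → 𝓑 (suc (suc i)) f → 𝓑 (suc i) g → 𝓑 (suc i) (t2^ f · g)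
  bψ : ∀ {f g} → 𝓑 1 f → 𝓑 0 g → no ⟦ f ⟧ ℕ.≤ F 2 (natOf ⟦ g ⟧) → 𝓑 0 (tψ f g)
  b0 : ∀ {i f} → 𝓑 0 f → 𝓑 i f

Subst : Set
Subst = OVar → Term ⊥

Admissible : Subst → Set
Admissible χ = (X : TVar) →
  ((i : Fin (suc (lv (TVar.ty X)))) → 𝓑 (toℕ i) (χ (X , i))) ×
  ((i : Fin (suc (lv (TVar.ty X)))) → no ⟦ χ (X , i) ⟧ ℕ.≤ no ⟦ χ (X , Fin.zero) ⟧)

infixl 6 _e+_
data Expr : Set where
  tm   : Term OVar → Expr
  eno  : Expr → Expr
  eF   : ℕ → Expr → Expr
  _e+_ : Expr → Expr → Expr

-- F_j applied to an ordinal; convention: value ω on infinite arguments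
Fapp : ℕ → O → O
Fapp j v = if isFin v then fromℕ (F j (natOf v)) else ωₒ

evE : Subst → Expr → O
evE χ (tm t) = ⟦ t [ χ ] ⟧
evE χ (eno e) = fromℕ (no (evE χ e))
evE χ (eF j e) = Fapp j (evE χ e)
evE χ (e e+ e') = evE χ e ⊕ evE χ e'

infix 4 _≺_ _⪯_
_≺_ : Expr → Expr → Set
e ≺ e' = (χ : Subst) → Admissible χ → evE χ e <ₒ evE χ e'

_⪯_ : Expr → Expr → Set
e ⪯ e' = (χ : Subst) → Admissible χ → evE χ e ≤ₒ evE χ e'

-- Vectors of ordinal terms; a vector of level n has n+1 components

TVec : ℕ → Set
TVec n = Vec (Term OVar) (suc n)

-- component h_i, with h_i := 0 beyond the level
comp : ∀ {k} → Vec (Term OVar) k → ℕ → Term OVar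
comp [] _ = t0
comp (x ∷ xs) zero = x
comp (x ∷ xs) (suc i) = comp xs i

-- f⃗ □ g⃗  (intended for lv f⃗ = m > n = lv g⃗)
module _ {m n : ℕ} (f : TVec m) (g : TVec n) where
  -- boxFrom (n+1-i) i = (f⃗□g⃗)_i  for i ≥ 1
  boxFrom : ℕ → ℕ → Term OVar
  boxFrom zero i = comp f i
  boxFrom (suc t) i = t2^ (boxFrom t (suc i)) · (comp f i t+ comp g i)

  boxComp : ℕ → Term OVar
  boxComp zero = tψ (boxFrom n 1) ((comp f 0 t+ comp g 0) t+ num n)
  boxComp (suc j) = boxFrom (n ∸ j) (suc j)

  _□_ : TVec m
  _□_ = tabulate (λ i → boxComp (toℕ i))

-- Every component of f □ g of index i ≥ 1 is a tower built from the f_j, g_j with j ≥ i: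
-- (f □ g)_i = 2^((f □ g)_(i+1)) · (f_i + g_i) for i ≤ n, and (f □ g)_i = f_i above n.
-- Since no(2^x · y) ≤ 2^no(x) · no(y), the norm of a component of height t is bounded by
-- t iterations of x ↦ 2^x · x ≤ F₁(x), started at p + q + n; at most n + 1 iterations
-- are needed, and F₂(x) is F₁ iterated x + 1 times. Below ω, every ordinal expression
-- evaluates to a numeral, which turns the comparisons ⪯ into inequalities of naturals.
module Submission where

open import Defs
open import Data.Nat using (ℕ; _<_; _≤_; zero; suc; _+_; _*_; _^_; _∸_; z≤n; s≤s; _≤?_)
open import Data.Nat.Properties
open import Data.Nat.Tactic.RingSolver using (solve-∀)
open import Data.Bool using (true; false; if_then_else_)
open import Data.Empty using (⊥-elim)
open import Data.Product using (_×_; _,_; proj₁; proj₂)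
open import Data.Sum using (inj₁; inj₂)
open import Data.Fin using (toℕ)
open import Data.Vec using (tabulate)
open import Relation.Nullary as Dec using (yes)
open import Relation.Binary.PropositionalEquality hiding ([_])

n<2^n : ∀ n → n < 2 ^ n
n<2^n zero = s≤s z≤n
n<2^n (suc n) = begin-strict
    suc n         <⟨ +-monoʳ-≤ 1 (n<2^n n) ⟩
    1 + 2 ^ n     ≤⟨ +-monoˡ-≤ (2 ^ n) (m^n>0 2 n) ⟩
    2 ^ n + 2 ^ n ≡⟨ cong (2 ^ n +_) (sym (+-identityʳ (2 ^ n))) ⟩
    2 ^ suc n     ∎
  where open ≤-Reasoning

Inflationary : (ℕ → ℕ) → Set
Inflationary h = ∀ x → x ≤ h x

iter-inflationary : ∀ {h} → Inflationary h → ∀ t y → y ≤ iter t h y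
iter-inflationary infl zero y = ≤-refl
iter-inflationary infl (suc t) y = ≤-trans (iter-inflationary infl t y) (infl _)

iter-monoˡ-≤ : ∀ {h} → Inflationary h → ∀ {t u} y → t ≤ u → iter t h y ≤ iter u h y
iter-monoˡ-≤ {h} infl {t} {u} y t≤u =
  subst (λ v → iter t h y ≤ iter v h y) (m∸n+n≡m t≤u) (iter-+ (u ∸ t))
  where
    iter-+ : ∀ d → iter t h y ≤ iter (d + t) h y
    iter-+ zero = ≤-refl
    iter-+ (suc d) = ≤-trans (iter-+ d) (infl _)

F0-inflationary : Inflationary (F 0)
F0-inflationary x = <⇒≤ (n<2^n x)

F1-inflationary : Inflationary (F 1)
F1-inflationary x = iter-inflationary F0-inflationary (suc x) x

n+n≤2^n : ∀ n → n + n ≤ 2 ^ n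
n+n≤2^n zero = z≤n
n+n≤2^n (suc n) = begin
    suc n + suc n ≤⟨ +-mono-≤ (n<2^n n) (n<2^n n) ⟩
    2 ^ n + 2 ^ n ≡⟨ cong (2 ^ n +_) (sym (+-identityʳ (2 ^ n))) ⟩
    2 ^ suc n     ∎
  where open ≤-Reasoning

2^n*n≤F1 : ∀ n → 2 ^ n * n ≤ F 1 n
2^n*n≤F1 zero = z≤n
2^n*n≤F1 n@(suc k) = begin
    2 ^ n * n       ≤⟨ *-monoʳ-≤ (2 ^ n) (<⇒≤ (n<2^n n)) ⟩
    2 ^ n * 2 ^ n   ≡⟨ sym (^-distribˡ-+-* 2 n n) ⟩
    2 ^ (n + n)     ≤⟨ ^-monoʳ-≤ 2 (n+n≤2^n n) ⟩
    F 0 (F 0 n)     ≤⟨ ^-monoʳ-≤ 2 (^-monoʳ-≤ 2 (iter-inflationary F0-inflationary k n)) ⟩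
    F 1 n           ∎
  where open ≤-Reasoning

iter-F1≤F2 : ∀ {t} x → t ≤ suc x → iter t (F 1) x ≤ F 2 x
iter-F1≤F2 x = iter-monoˡ-≤ F1-inflationary x

fromℕ-⊕ : ∀ a b → fromℕ a ⊕ fromℕ b ≡ fromℕ (a + b)
fromℕ-⊕ zero b = refl
fromℕ-⊕ (suc a) zero = cong fromℕ (sym (+-identityʳ (suc a)))
fromℕ-⊕ (suc a) (suc b) = cong (ω^ 𝟎 +_) (fromℕ-⊕ a (suc b))

natOf-fromℕ : ∀ a → natOf (fromℕ a) ≡ a
natOf-fromℕ zero = refl
natOf-fromℕ (suc a) = cong suc (natOf-fromℕ a)

fromℕ-mono-≤ : ∀ {a b} → a ≤ b → fromℕ a ≤ₒ fromℕ b
fromℕ-mono-≤ {zero} {zero} _ = inj₂ refl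
fromℕ-mono-≤ {zero} {suc b} _ = inj₁ <₁
fromℕ-mono-≤ (s≤s a≤b) with fromℕ-mono-≤ a≤b
... | inj₁ lt = inj₁ (<₃ refl lt)
... | inj₂ eq = inj₂ (cong (ω^ 𝟎 +_) eq)

fromℕ-cancel-≤ : ∀ {a b} → fromℕ a ≤ₒ fromℕ b → a ≤ b
fromℕ-cancel-≤ {a} {b} (inj₂ eq) =
  ≤-reflexive (trans (sym (natOf-fromℕ a)) (trans (cong natOf eq) (natOf-fromℕ b)))
fromℕ-cancel-≤ {zero} (inj₁ _) = z≤n
fromℕ-cancel-≤ {suc a} {suc b} (inj₁ (<₃ _ lt)) = s≤s (fromℕ-cancel-≤ (inj₁ lt))

Fapp-fromℕ : ∀ j a → Fapp j (fromℕ a) ≡ fromℕ (F j a)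
Fapp-fromℕ j zero = refl
Fapp-fromℕ j (suc a) = cong (λ x → fromℕ (F j (suc x))) (natOf-fromℕ a)

evE-num : ∀ χ n → evE χ (tm (num n)) ≡ fromℕ n
evE-num χ zero = refl
evE-num χ (suc n) = trans (cong (oneₒ ⊕_) (evE-num χ n)) (fromℕ-⊕ 1 n)

<ω⇒fst≡𝟎 : ∀ {v} → v <ₒ ωₒ → fst v ≡ 𝟎
<ω⇒fst≡𝟎 <₁ = refl
<ω⇒fst≡𝟎 (<₂ <₁) = refl
<ω⇒fst≡𝟎 (<₂ (<₂ ()))
<ω⇒fst≡𝟎 (<₂ (<₃ _ ()))
<ω⇒fst≡𝟎 (<₃ _ ())

-- Raw trees such as ω^ 𝟎 + ω^ oneₒ + 𝟎 have leading exponent 𝟎 without being finite,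
-- so this property is established for the values of expressions only.
NumeralIfFinite : O → Set
NumeralIfFinite v = fst v ≡ 𝟎 → v ≡ fromℕ (natOf v)

fst-⊕≡𝟎 : ∀ v w → fst (v ⊕ w) ≡ 𝟎 → fst v ≡ 𝟎 × fst w ≡ 𝟎
fst-⊕≡𝟎 𝟎 w h = refl , h
fst-⊕≡𝟎 (ω^ a + a') 𝟎 h = h , refl
fst-⊕≡𝟎 (ω^ a + a') (ω^ b + b') h with a <?ₒ b
fst-⊕≡𝟎 (ω^ a + a') (ω^ .𝟎 + b') refl | yes ()
fst-⊕≡𝟎 (ω^ .𝟎 + a') (ω^ 𝟎 + b') refl | Dec.no _ = refl , refl
fst-⊕≡𝟎 (ω^ .𝟎 + a') (ω^ (ω^ _ + _) + b') refl | Dec.no 𝟎≮b = ⊥-elim (𝟎≮b <₁)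

⊕-numeralIfFinite : ∀ v w → NumeralIfFinite v → NumeralIfFinite w → NumeralIfFinite (v ⊕ w)
⊕-numeralIfFinite v w nv nw h with fst-⊕≡𝟎 v w h
... | hv , hw = trans v⊕w≡ (cong fromℕ (sym (trans (cong natOf v⊕w≡) (natOf-fromℕ _))))
  where
    v⊕w≡ : v ⊕ w ≡ fromℕ (natOf v + natOf w)
    v⊕w≡ = trans (cong₂ _⊕_ (nv hv) (nw hw)) (fromℕ-⊕ (natOf v) (natOf w))

fromℕ-numeralIfFinite : ∀ a → NumeralIfFinite (fromℕ a)
fromℕ-numeralIfFinite a _ = cong fromℕ (sym (natOf-fromℕ a))

mulT-numeralIfFinite : ∀ a y → NumeralIfFinite (mulT a y)
mulT-numeralIfFinite a 𝟎 _ = refl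
mulT-numeralIfFinite a (ω^ b + b') =
  ⊕-numeralIfFinite _ _ (λ h → cong (ω^_+ 𝟎) h) (mulT-numeralIfFinite a b')

⊗-numeralIfFinite : ∀ x y → NumeralIfFinite (x ⊗ y)
⊗-numeralIfFinite 𝟎 y _ = refl
⊗-numeralIfFinite (ω^ a + a') y =
  ⊕-numeralIfFinite _ _ (mulT-numeralIfFinite a y) (⊗-numeralIfFinite a' y)

evalWith-numeralIfFinite : ∀ {V : Set} (ρ : V → O) → (∀ x → NumeralIfFinite (ρ x)) →
                           ∀ t → NumeralIfFinite (evalWith ρ t)
evalWith-numeralIfFinite ρ nρ (var x) = nρ x
evalWith-numeralIfFinite ρ nρ t0 _ = refl
evalWith-numeralIfFinite ρ nρ t1 _ = refl
evalWith-numeralIfFinite ρ nρ tω ()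
evalWith-numeralIfFinite ρ nρ (f t+ g) =
  ⊕-numeralIfFinite _ _ (evalWith-numeralIfFinite ρ nρ f) (evalWith-numeralIfFinite ρ nρ g)
evalWith-numeralIfFinite ρ nρ (t2^ f · g) =
  ⊗-numeralIfFinite (two^ (evalWith ρ f)) (evalWith ρ g)
evalWith-numeralIfFinite ρ nρ (tψ f g) = fromℕ-numeralIfFinite _

evE-numeralIfFinite : ∀ χ e → NumeralIfFinite (evE χ e)
evE-numeralIfFinite χ (tm t) = evalWith-numeralIfFinite ⊥-elim (λ ()) (t [ χ ])
evE-numeralIfFinite χ (eno e) = fromℕ-numeralIfFinite _
evE-numeralIfFinite χ (eF j e) with isFin (evE χ e)
... | true = fromℕ-numeralIfFinite _
... | false = λ ()
evE-numeralIfFinite χ (e e+ e') =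
  ⊕-numeralIfFinite _ _ (evE-numeralIfFinite χ e) (evE-numeralIfFinite χ e')

evE-<ω : ∀ χ e → evE χ e <ₒ ωₒ → evE χ e ≡ fromℕ (natOf (evE χ e))
evE-<ω χ e lt = evE-numeralIfFinite χ e (<ω⇒fst≡𝟎 lt)

no-⊕ : ∀ v w → no (v ⊕ w) ≡ no v + no w
no-⊕ 𝟎 w = refl
no-⊕ (ω^ a + a') 𝟎 = sym (+-identityʳ _)
-- The recursive calls are made before the case split on a < b, where the termination
-- checker still sees them as structural.
no-⊕ x@(ω^ a + a') y@(ω^ b + b') =
  by-order (Dec.does (a <?ₒ b)) (no-⊕ x b') (no-⊕ a' y)
  where
    by-order : ∀ c → no (x ⊕ b') ≡ no x + no b' → no (a' ⊕ y) ≡ no a' + no y →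
               no (if c then ω^ b + (x ⊕ b') else ω^ a + (a' ⊕ y)) ≡ no x + no y
    by-order true ih _ = trans (cong (λ s → suc (no b + s)) ih) (shuffle (no x) (no b) (no b'))
      where
        shuffle : ∀ s t u → suc (t + (s + u)) ≡ s + suc (t + u)
        shuffle = solve-∀
    by-order false _ ih = cong suc (trans (cong (no a +_) ih) (sym (+-assoc (no a) (no a') (no y))))

no-mulT : ∀ a y → no (mulT a y) ≤ suc (no a) * no y
no-mulT a 𝟎 = z≤n
no-mulT a (ω^ b + b') = begin
    no (ω^ (a ⊕ b) + 𝟎 ⊕ mulT a b')     ≡⟨ no-⊕ (ω^ (a ⊕ b) + 𝟎) (mulT a b') ⟩
    suc (no (a ⊕ b) + 0) + no (mulT a b') ≡⟨ cong (λ x → suc (x + 0) + no (mulT a b')) (no-⊕ a b) ⟩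
    suc (no a + no b + 0) + no (mulT a b') ≤⟨ +-monoʳ-≤ _ (no-mulT a b') ⟩
    suc (no a + no b + 0) + A * no b'     ≤⟨ +-monoˡ-≤ _ (s≤s (+-monoˡ-≤ 0 (+-monoʳ-≤ (no a) (m≤n*m (no b) A)))) ⟩
    suc (no a + A * no b + 0) + A * no b' ≡⟨ collect (no a) (no b) (no b') ⟩
    A * no (ω^ b + b')                    ∎
  where
    open ≤-Reasoning
    A = suc (no a)
    collect : ∀ x y z → suc (x + suc x * y + 0) + suc x * z ≡ suc x * suc (y + z)
    collect = solve-∀

no-⊗ : ∀ x y → no (x ⊗ y) ≤ no x * no y
no-⊗ 𝟎 y = z≤n
no-⊗ (ω^ a + a') y = begin
    no (mulT a y ⊕ a' ⊗ y)            ≡⟨ no-⊕ (mulT a y) (a' ⊗ y) ⟩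
    no (mulT a y) + no (a' ⊗ y)       ≤⟨ +-mono-≤ (no-mulT a y) (no-⊗ a' y) ⟩
    suc (no a) * no y + no a' * no y  ≡⟨ sym (*-distribʳ-+ (no y) (suc (no a)) (no a')) ⟩
    no (ω^ a + a') * no y             ∎
  where open ≤-Reasoning

no-rep : ∀ c a → no (rep c a) ≡ c * suc (no a)
no-rep zero a = refl
no-rep (suc c) a = cong (λ x → suc (no a + x)) (no-rep c a)

no-pred₁ : ∀ e → no (pred₁ e) ≤ no e
no-pred₁ 𝟎 = ≤-refl
no-pred₁ (ω^ 𝟎 + r) = n≤1+n (no r)
no-pred₁ (ω^ (ω^ _ + _) + r) = ≤-refl

no-split : ∀ α → no (proj₁ (split α)) + proj₂ (split α) ≤ no α
no-split 𝟎 = z≤n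
no-split (ω^ 𝟎 + r) =
  subst (_≤ suc (no r)) (sym (+-suc (no (proj₁ (split r))) _)) (s≤s (no-split r))
no-split (ω^ e@(ω^ _ + _) + r) =
  s≤s (subst (_≤ no e + no r) (sym (+-assoc (no (pred₁ e)) _ _))
             (+-mono-≤ (no-pred₁ e) (no-split r)))

no-two^ : ∀ α → no (two^ α) ≤ 2 ^ no α
no-two^ α = begin
    no (two^ α)          ≡⟨ no-rep (2 ^ k) α₀ ⟩
    2 ^ k * suc (no α₀)  ≤⟨ *-monoʳ-≤ (2 ^ k) (n<2^n (no α₀)) ⟩
    2 ^ k * 2 ^ no α₀    ≡⟨ sym (^-distribˡ-+-* 2 k (no α₀)) ⟩
    2 ^ (k + no α₀)      ≤⟨ ^-monoʳ-≤ 2 (subst (_≤ no α) (+-comm (no α₀) k) (no-split α)) ⟩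
    2 ^ no α             ∎
  where
    open ≤-Reasoning
    α₀ = proj₁ (split α)
    k = proj₂ (split α)

comp-tabulate : ∀ N (φ : ℕ → Term OVar) i → i < N →
                comp (tabulate {n = N} (λ j → φ (toℕ j))) i ≡ φ i
comp-tabulate (suc N) φ zero _ = refl
comp-tabulate (suc N) φ (suc i) (s≤s i<N) = comp-tabulate N (λ j → φ (suc j)) i i<N

comp-□ : ∀ {m n} (f : TVec m) (g : TVec n) j → j < m →
         comp (f □ g) (suc j) ≡ boxFrom f g (n ∸ j) (suc j)
comp-□ {m} f g j j<m = comp-tabulate (suc m) (boxComp f g) (suc j) (s≤s j<m)

module □-Norm {m n : ℕ} (f : TVec m) (g : TVec n) (n<m : n < m) (k : ℕ) (χ : Subst) (P Q : ℕ)
  (f≤P : ∀ i → k ≤ i → i ≤ m → no ⟦ comp f i [ χ ] ⟧ ≤ P)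
  (g≤Q : ∀ i → k ≤ i → i ≤ n → no ⟦ comp g i [ χ ] ⟧ ≤ Q) where

  private
    N = P + Q + n

    P+Q≤iter : ∀ t → P + Q ≤ iter t (F 1) N
    P+Q≤iter t = ≤-trans (m≤m+n (P + Q) n) (iter-inflationary F1-inflationary t N)

    P≤N : P ≤ N
    P≤N = ≤-trans (m≤m+n P Q) (P+Q≤iter 0)

  boxFrom-norm : ∀ t i → k ≤ i → t + i ≤ suc n → no ⟦ boxFrom f g t i [ χ ] ⟧ ≤ iter t (F 1) N
  boxFrom-norm zero i k≤i i≤1+n = ≤-trans (f≤P i k≤i (≤-trans i≤1+n n<m)) P≤N
  boxFrom-norm (suc t) i k≤i 1+t+i≤1+n = begin
      no (two^ x ⊗ (y ⊕ z))              ≤⟨ no-⊗ (two^ x) (y ⊕ z) ⟩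
      no (two^ x) * no (y ⊕ z)           ≤⟨ *-mono-≤ (no-two^ x) (≤-reflexive (no-⊕ y z)) ⟩
      2 ^ no x * (no y + no z)           ≤⟨ *-mono-≤ (^-monoʳ-≤ 2 x≤) (+-mono-≤ y≤ z≤) ⟩
      2 ^ iter t (F 1) N * (P + Q)       ≤⟨ *-monoʳ-≤ (2 ^ iter t (F 1) N) (P+Q≤iter t) ⟩
      2 ^ iter t (F 1) N * iter t (F 1) N ≤⟨ 2^n*n≤F1 (iter t (F 1) N) ⟩
      iter (suc t) (F 1) N               ∎
    where
      open ≤-Reasoning
      x = ⟦ boxFrom f g t (suc i) [ χ ] ⟧
      y = ⟦ comp f i [ χ ] ⟧
      z = ⟦ comp g i [ χ ] ⟧
      i≤n : i ≤ n
      i≤n = ≤-trans (m≤n+m i t) (≤-pred 1+t+i≤1+n)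
      x≤ : no x ≤ iter t (F 1) N
      x≤ = boxFrom-norm t (suc i) (≤-trans k≤i (n≤1+n i))
             (subst (_≤ suc n) (sym (+-suc t i)) 1+t+i≤1+n)
      y≤ : no y ≤ P
      y≤ = f≤P i k≤i (≤-trans i≤n (<⇒≤ n<m))
      z≤ : no z ≤ Q
      z≤ = g≤Q i k≤i i≤n

  □-norm : ∀ i → 1 ≤ i → k ≤ i → i ≤ m → no ⟦ comp (f □ g) i [ χ ] ⟧ ≤ F 2 N
  □-norm (suc j) _ k≤i i≤m = ≤-trans tower-norm (iter-F1≤F2 N height≤)
    where
      height≤ : n ∸ j ≤ suc N
      height≤ = ≤-trans (m∸n≤m n j) (≤-trans (m≤n+m n (P + Q)) (n≤1+n N))
      -- For j > n the truncated height n ∸ j is 0 and the component is f_(j+1) itself.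
      tower-norm : no ⟦ comp (f □ g) (suc j) [ χ ] ⟧ ≤ iter (n ∸ j) (F 1) N
      tower-norm rewrite comp-□ f g j i≤m with j ≤? n
      ... | yes j≤n = boxFrom-norm (n ∸ j) (suc j) k≤i
                        (≤-reflexive (trans (+-suc (n ∸ j) j) (cong suc (m∸n+n≡m j≤n))))
      ... | Dec.no j≰n rewrite m≤n⇒m∸n≡0 (<⇒≤ (≰⇒> j≰n)) = ≤-trans (f≤P (suc j) k≤i i≤m) P≤N

lemma2p11 : {m n : ℕ} (f : TVec m) (g : TVec n) → n < m →
            (k : ℕ) → 1 ≤ k → k ≤ m →
            (p q : Expr) → p ≺ tm tω → q ≺ tm tω →
            ((i : ℕ) → k ≤ i → i ≤ m → eno (tm (comp f i)) ⪯ p) →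
            ((i : ℕ) → k ≤ i → i ≤ n → eno (tm (comp g i)) ⪯ q) →
            (i : ℕ) → k ≤ i → i ≤ m →
            eno (tm (comp (f □ g) i)) ⪯ eF 2 (p e+ q e+ tm (num n))
lemma2p11 {m} {n} f g n<m k 1≤k _ p q p<ω q<ω f⪯p g⪯q i k≤i i≤m χ adm =
  subst (fromℕ (no ⟦ comp (f □ g) i [ χ ] ⟧) ≤ₒ_) (sym bound≡)
    (fromℕ-mono-≤ (□-norm i (≤-trans 1≤k k≤i) k≤i i≤m))
  where
    P = natOf (evE χ p)
    Q = natOf (evE χ q)
    p≡P : evE χ p ≡ fromℕ P
    p≡P = evE-<ω χ p (p<ω χ adm)
    q≡Q : evE χ q ≡ fromℕ Q
    q≡Q = evE-<ω χ q (q<ω χ adm)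
    open □-Norm f g n<m k χ P Q
      (λ j k≤j j≤m → fromℕ-cancel-≤ (subst (_ ≤ₒ_) p≡P (f⪯p j k≤j j≤m χ adm)))
      (λ j k≤j j≤n → fromℕ-cancel-≤ (subst (_ ≤ₒ_) q≡Q (g⪯q j k≤j j≤n χ adm)))
    bound≡ : evE χ (eF 2 (p e+ q e+ tm (num n))) ≡ fromℕ (F 2 (P + Q + n))
    bound≡ = begin
      Fapp 2 (evE χ p ⊕ evE χ q ⊕ evE χ (tm (num n))) ≡⟨ cong (Fapp 2) (cong₂ _⊕_ (cong₂ _⊕_ p≡P q≡Q) (evE-num χ n)) ⟩
      Fapp 2 (fromℕ P ⊕ fromℕ Q ⊕ fromℕ n)           ≡⟨ cong (λ s → Fapp 2 (s ⊕ fromℕ n)) (fromℕ-⊕ P Q) ⟩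
      Fapp 2 (fromℕ (P + Q) ⊕ fromℕ n)               ≡⟨ cong (Fapp 2) (fromℕ-⊕ (P + Q) n) ⟩
      Fapp 2 (fromℕ (P + Q + n))                     ≡⟨ Fapp-fromℕ 2 (P + Q + n) ⟩
      fromℕ (F 2 (P + Q + n))                        ∎
      where open ≡-Reasoning
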